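{- Let $q\in\mathbb{N}$ with $q\ge 3$ and let $\mathcal{A}\subseteq\{0,1,\ldots,q-1\}$ with $1<\#\mathcal{A}<q$. Let $p_1,\ldots,p_\ell\in\mathbb{N}_{\ge2}$ be such that each $p_j$ has a prime factor that does not divide $q$. Then for every positive rational $\alpha$, the set $\{(k_1,\ldots,k_\ell)\in\mathbb{N}_0^\ell: \alpha/(p_1^{k_1}\cdots p_\ell^{k_\ell})\in K(q,\mathcal{A})\}$ is finite.
   Context: $\mathbb{N}_0=\mathbb{N}\cup\{0\}$. $K(q,\mathcal{A}):=\{\sum_{i=1}^\infty d_i q^{ -i}: d_i\in\mathcal{A}\ \forall i\in\mathbb{N}\}$. -}

module Defs where

open import Data.Nat as ℕ using (ℕ; zero; suc; _^_; NonZero)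
open import Data.Nat.Properties using (m^n≢0)
open import Data.Nat.Divisibility using (_∣_)
open import Data.Nat.Primality using (Prime)
open import Data.Integer using (+_)
open import Data.Rational using (ℚ; 0ℚ; _/_; _+_; _-_; _*_; _<_; ∣_∣; Positive)
open import Data.Fin using (Fin; toℕ)
open import Data.Fin.Subset using (Subset) renaming (_∈_ to _∈ˢ_)
open import Data.Vec using (Vec; []; _∷_)
open import Data.List using (List)
open import Data.List.Membership.Propositional renaming (_∈_ to _∈ˡ_)
open import Data.Product using (Σ; ∃; _×_)
open import Relation.Nullary using (¬_)
open import Relation.Binary.PropositionalEquality using (_≡_)

-- the i-th term (i = 0,1,2,...) of the series: d i / q^(i+1),
-- i.e. d i plays the role of the digit d_{i+1} of the paper.
digitTerm : (q : ℕ) .{{_ : NonZero q}} → (ℕ → Fin q) → ℕ → ℚ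
digitTerm q d i = (+ toℕ (d i) / (q ^ suc i)) {{m^n≢0 q (suc i)}}

partialSum : (q : ℕ) .{{_ : NonZero q}} → (ℕ → Fin q) → ℕ → ℚ
partialSum q d zero    = 0ℚ
partialSum q d (suc n) = partialSum q d n + digitTerm q d n

SumsTo : (q : ℕ) .{{_ : NonZero q}} → (ℕ → Fin q) → ℚ → Set
SumsTo q d x = ∀ (ε : ℚ) → Positive ε →
  ∃ λ (N : ℕ) → ∀ (n : ℕ) → N ℕ.≤ n → ∣ partialSum q d n - x ∣ < ε

InK : (q : ℕ) .{{_ : NonZero q}} → Subset q → ℚ → Set
InK q 𝒜 x = Σ (ℕ → Fin q) λ d → (∀ i → d i ∈ˢ 𝒜) × SumsTo q d x

HasPrimeFactorNotDividing : ℕ → ℕ → Set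
HasPrimeFactorNotDividing q p = ∃ λ r → Prime r × r ∣ p × ¬ (r ∣ q)

prodPow : ∀ {ℓ} → Vec ℕ ℓ → Vec ℕ ℓ → ℕ
prodPow []       []       = 1
prodPow (p ∷ ps) (k ∷ ks) = p ^ k ℕ.* prodPow ps ks

FiniteSet : ∀ {ℓ} → (Vec ℕ ℓ → Set) → Set
FiniteSet {ℓ} P = ∃ λ (L : List (Vec ℕ ℓ)) → ∀ ks → P ks → ks ∈ˡ L

{-# OPTIONS --safe #-}
module Submission where

-- Fix a digit m ∉ 𝒜. If q^(n+1)·x lies strictly between qN + m and qN + m + 1,
-- then every base-q expansion of x has m as its (n+1)-st digit, so x ∉ K(q,𝒜).
-- Let r be a prime dividing p_j but not q, and x = α / ∏ p_i^(k_i). Up to a power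
-- of q, x = c / (r^E·L^e) with r ∤ c and L a fixed number prime to q and r, where
-- E grows with k_j. Lifting the exponent gives q^T = 1 + r^h·L^e·w with r ∤ w and
-- r^E = r^G·r^h, r^G > q. As c·w is invertible modulo r^G, the orbit of c under
-- multiplication by q meets c + k·r^h·L^e modulo r^E·L^e for every k; divided by
-- the denominator these points are 1/r^G < 1/q apart, so one of them falls into
-- the window of the digit m. Hence every k_j is bounded.

open import Defs

module _ where

  open import Data.Empty using (⊥-elim)
  open import Data.Fin using (Fin; zero; suc; toℕ; fromℕ<)
  open import Data.Fin.Properties using (pigeonhole; toℕ-fromℕ<; toℕ<n; toℕ-injective)
  open import Data.Fin.Subset using (Subset; ∣_∣; _∈_; _∉_; inside; outside)
  open import Data.Integer as ℤ using (_⊖_)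
  import Data.Integer.Properties as ℤ
  open import Data.List using (List; upTo; cartesianProductWith)
  import Data.List.Membership.Propositional as List
  open import Data.List.Membership.Propositional.Properties using (∈-upTo⁺; ∈-cartesianProductWith⁺)
  import Data.List.Relation.Unary.Any as List
  open import Data.Nat
  open import Data.Nat.Coprimality using (Coprime; coprime?; coprime-divisor; gcd≡1⇒coprime)
  open import Data.Nat.Divisibility
  open import Data.Nat.DivMod
  open import Data.Nat.GCD using (gcd; gcd[m,n]∣m; gcd[m,n]∣n; gcd[m,n]≡0⇒m≡0)
  open import Data.Nat.Induction using (<-rec)
  open import Data.Nat.Primality
  open import Data.Nat.Properties
  open import Data.Nat.Tactic.RingSolver
  open import Data.Product
  open import Data.Rational as ℚ using (ℚ; mkℚ; toℚᵘ)
  import Data.Rational.Properties as ℚ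
  open import Data.Rational.Unnormalised as ℚᵘ using (mkℚᵘ; *≡*; *<*)
  import Data.Rational.Unnormalised.Properties as ℚᵘ
  open import Data.Sum using (inj₁; inj₂)
  open import Data.Vec using (Vec; []; _∷_; lookup; sum; there)
  open import Function using (_∘_)
  open import Relation.Binary.PropositionalEquality
  open import Relation.Nullary using (¬_; yes; no)

  private variable
    a b q r y : ℕ

  ^-distribʳ-* : ∀ x y n → (x * y) ^ n ≡ x ^ n * y ^ n
  ^-distribʳ-* x y zero    = refl
  ^-distribʳ-* x y (suc n) = trans (cong (x * y *_) (^-distribʳ-* x y n)) (shuffle x y (x ^ n) (y ^ n))
    where
    shuffle : ∀ a b c d → a * b * (c * d) ≡ a * c * (b * d)
    shuffle = solve-∀

  n<2^n : ∀ n → n < 2 ^ n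
  n<2^n zero    = z<s
  n<2^n (suc n) = subst (suc n <_) (cong (2 ^ n +_) (sym (+-identityʳ (2 ^ n))))
                        (+-mono-≤ (m^n>0 2 n) (n<2^n n))

  ^-monoˡ-∣ : ∀ {a b} → a ∣ b → ∀ n → a ^ n ∣ b ^ n
  ^-monoˡ-∣ a∣b zero    = ∣-refl
  ^-monoˡ-∣ a∣b (suc n) = *-pres-∣ a∣b (^-monoˡ-∣ a∣b n)

  ^-monoʳ-∣ : ∀ x {m n} → m ≤ n → x ^ m ∣ x ^ n
  ^-monoʳ-∣ x {m} m≤n with m≤n⇒∃[o]m+o≡n m≤n
  ... | o , refl = divides (x ^ o) (trans (^-distribˡ-+-* x m o) (*-comm (x ^ m) (x ^ o)))

  m*n>0⇒m>0 : ∀ m n → 0 < m * n → 0 < m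
  m*n>0⇒m>0 (suc m) n _ = z<s

  m*n>0⇒n>0 : ∀ m n → 0 < m * n → 0 < n
  m*n>0⇒n>0 m n 0<mn = m*n>0⇒m>0 n m (subst (0 <_) (*-comm m n) 0<mn)

  ≢0∧≢1⇒1< : ∀ {n} → n ≢ 0 → n ≢ 1 → 1 < n
  ≢0∧≢1⇒1< {zero}        n≢0 _   = ⊥-elim (n≢0 refl)
  ≢0∧≢1⇒1< {suc zero}    _   n≢1 = ⊥-elim (n≢1 refl)
  ≢0∧≢1⇒1< {suc (suc n)} _   _   = s≤s (s≤s z≤n)

  %-≡⇒≡+*  : ∀ x y M .{{_ : NonZero M}} → x % M ≡ y % M → x ≤ y → ∃ λ k → y ≡ x + k * M
  %-≡⇒≡+* x y M x%M≡y%M x≤y = y / M ∸ x / M , (begin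
    y                                         ≡⟨ m≡m%n+[m/n]*n y M ⟩
    y % M + (y / M) * M                       ≡⟨ cong₂ (λ u v → u + v * M) (sym x%M≡y%M) (sym (m+[n∸m]≡n (/-monoˡ-≤ M x≤y))) ⟩
    x % M + (x / M + (y / M ∸ x / M)) * M     ≡⟨ shuffle (x % M) (x / M) (y / M ∸ x / M) M ⟩
    x % M + (x / M) * M + (y / M ∸ x / M) * M ≡⟨ cong (_+ (y / M ∸ x / M) * M) (sym (m≡m%n+[m/n]*n x M)) ⟩
    x + (y / M ∸ x / M) * M                   ∎)
    where
    open ≡-Reasoning
    shuffle : ∀ a b c d → a + (b + c) * d ≡ a + b * d + c * d
    shuffle = solve-∀

  -- Primes and valuations

  prime⇒2≤ : Prime r → 2 ≤ r
  prime⇒2≤ {r} r-prime = nonTrivial⇒n>1 r {{prime⇒nonTrivial r-prime}}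

  prime-∤-* : Prime r → r ∤ a → r ∤ b → r ∤ a * b
  prime-∤-* {a = a} {b} r-prime r∤a r∤b r∣ab with euclidsLemma a b r-prime r∣ab
  ... | inj₁ r∣a = r∤a r∣a
  ... | inj₂ r∣b = r∤b r∣b

  prime-∤-^ : Prime r → r ∤ a → ∀ k → r ∤ a ^ k
  prime-∤-^ r-prime r∤a zero    r∣1 = <⇒≢ (prime⇒2≤ r-prime) (sym (∣1⇒≡1 r∣1))
  prime-∤-^ r-prime r∤a (suc k) = prime-∤-* r-prime r∤a (prime-∤-^ r-prime r∤a k)

  prime∤⇒coprime : Prime r → r ∤ a → Coprime a r
  prime∤⇒coprime r-prime r∤a (d∣a , d∣r) with prime⇒irreducible r-prime d∣r
  ... | inj₁ d≡1 = d≡1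
  ... | inj₂ refl = ⊥-elim (r∤a d∣a)

  prime-∤-∣^ : ∀ {a t} → Prime r → r ∤ q → a ∣ q ^ t → r ∤ a
  prime-∤-∣^ {t = t} r-prime r∤q a∣q^t r∣a = prime-∤-^ r-prime r∤q t (∣-trans r∣a a∣q^t)

  prime-power-factor : Prime r → 0 < y → ∃₂ λ a y′ → y ≡ r ^ a * y′ × r ∤ y′
  prime-power-factor {r} {y} r-prime = <-rec P step y
    where
    P : ℕ → Set
    P y = 0 < y → ∃₂ λ a y′ → y ≡ r ^ a * y′ × r ∤ y′
    divide-out : ∀ y′ → (∀ {x} → x < y′ * r → P x) → P (y′ * r)
    divide-out y′ rec 0<y with rec (m<m*n y′ r {{>-nonZero 0<y′}} (prime⇒2≤ r-prime)) 0<y′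
      where 0<y′ = m*n>0⇒m>0 y′ r 0<y
    ... | a , y″ , refl , r∤y″ = suc a , y″ , shuffle r (r ^ a) y″ , r∤y″
      where
      shuffle : ∀ a b c → b * c * a ≡ a * b * c
      shuffle = solve-∀
    step : ∀ y → (∀ {x} → x < y → P x) → P y
    step y rec with r ∣? y
    ... | no r∤y                = λ _ → 0 , y , sym (+-identityʳ y) , r∤y
    ... | yes (divides y′ refl) = divide-out y′ rec

  prime-power-∣⇒≤ : ∀ {n m} → Prime r → r ^ n ∣ r ^ m * y → r ∤ y → n ≤ m
  prime-power-∣⇒≤ {r} {y} {n} {m} r-prime r^n∣ r∤y with n ≤? m
  ... | yes n≤m = n≤m
  ... | no n≰m with m≤n⇒∃[o]m+o≡n (≰⇒> n≰m)
  ...   | k , refl = ⊥-elim (r∤y (∣-trans (m∣m*n (r ^ k)) r^[1+k]∣y))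
    where
    instance
      r^m≢0 : NonZero (r ^ m)
      r^m≢0 = m^n≢0 r m {{prime⇒nonZero r-prime}}
    split : r ^ (suc m + k) ≡ r ^ m * r ^ suc k
    split = trans (cong (r ^_) (sym (+-suc m k))) (^-distribˡ-+-* r m (suc k))
    r^[1+k]∣y : r ^ suc k ∣ y
    r^[1+k]∣y = *-cancelˡ-∣ (r ^ m) (subst (_∣ r ^ m * y) split r^n∣)

  smooth-coprime-split : ∀ q → 0 < y → ∃₂ λ y₁ y₂ → ∃ λ t → y ≡ y₁ * y₂ × y₁ ∣ q ^ t × Coprime y₂ q
  smooth-coprime-split {y} q = <-rec P step y
    where
    P : ℕ → Set
    P y = 0 < y → ∃₂ λ y₁ y₂ → ∃ λ t → y ≡ y₁ * y₂ × y₁ ∣ q ^ t × Coprime y₂ q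
    divide-out : ∀ y y′ → y ≡ y′ * gcd y q → gcd y q ≢ 1 → (∀ {x} → x < y → P x) → P y
    divide-out y y′ y≡y′g g≢1 rec 0<y with rec y′<y 0<y′
      where
      g≢0 : gcd y q ≢ 0
      g≢0 g≡0 = >⇒≢ 0<y (gcd[m,n]≡0⇒m≡0 g≡0)
      0<y′ : 0 < y′
      0<y′ = m*n>0⇒m>0 y′ (gcd y q) (subst (0 <_) y≡y′g 0<y)
      y′<y : y′ < y
      y′<y = subst (y′ <_) (sym y≡y′g) (m<m*n y′ (gcd y q) {{>-nonZero 0<y′}} (≢0∧≢1⇒1< g≢0 g≢1))
    ... | y₁ , y₂ , t , refl , y₁∣q^t , y₂⊥q =
      gcd y q * y₁ , y₂ , suc t , trans y≡y′g (shuffle y₁ y₂ (gcd y q)) , *-pres-∣ (gcd[m,n]∣n y q) y₁∣q^t , y₂⊥q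
      where
      shuffle : ∀ a b c → a * b * c ≡ c * a * b
      shuffle = solve-∀
    step : ∀ y → (∀ {x} → x < y → P x) → P y
    step y rec with coprime? y q | gcd[m,n]∣m y q
    ... | yes y⊥q | _                  = λ _ → 1 , y , 0 , sym (*-identityˡ y) , ∣-refl , y⊥q
    ... | no ¬y⊥q | divides y′ y≡y′g = divide-out y y′ y≡y′g (¬y⊥q ∘ gcd≡1⇒coprime) rec

  -- Units modulo M

  _IsUnitMod_ : ℕ → ℕ → Set
  q IsUnitMod M = ∀ i z → M ∣ q ^ i * z → M ∣ z

  coprime⇒isUnitMod : ∀ {M q} → Coprime M q → q IsUnitMod M
  coprime⇒isUnitMod M⊥q zero    z M∣z    = subst (_ ∣_) (+-identityʳ z) M∣z
  coprime⇒isUnitMod {M} {q} M⊥q (suc i) z M∣qq^iz =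
    coprime⇒isUnitMod M⊥q i z (coprime-divisor M⊥q (subst (M ∣_) (*-assoc q (q ^ i) z) M∣qq^iz))

  prime∤⇒isUnitMod : Prime r → r ∤ q → q IsUnitMod r
  prime∤⇒isUnitMod {q = q} r-prime r∤q i z r∣q^iz with euclidsLemma (q ^ i) z r-prime r∣q^iz
  ... | inj₁ r∣q^i = ⊥-elim (prime-∤-^ r-prime r∤q i r∣q^i)
  ... | inj₂ r∣z   = r∣z

  isUnitMod-* : ∀ {M q N} .{{_ : NonZero M}} → q IsUnitMod M → q IsUnitMod N → q IsUnitMod (M * N)
  isUnitMod-* {M} {q} {N} unitM unitN i z MN∣q^iz with unitM i z (∣-trans (m∣m*n N) MN∣q^iz)
  ... | divides z′ refl = subst (M * N ∣_) (*-comm M z′) (*-monoʳ-∣ M (unitN i z′ N∣q^iz′))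
    where
    N∣q^iz′ : N ∣ q ^ i * z′
    N∣q^iz′ = *-cancelˡ-∣ M (subst (M * N ∣_) (shuffle (q ^ i) z′ M) MN∣q^iz)
      where
      shuffle : ∀ a b c → a * (b * c) ≡ c * (a * b)
      shuffle = solve-∀

  isUnitMod-^ : ∀ {M q} .{{_ : NonZero M}} → q IsUnitMod M → ∀ e → q IsUnitMod (M ^ e)
  isUnitMod-^ unitM zero    i z _ = 1∣ z
  isUnitMod-^ {M} unitM (suc e) = isUnitMod-* unitM (isUnitMod-^ unitM e)
    where
    instance
      M^e≢0 : NonZero (M ^ e)
      M^e≢0 = m^n≢0 M e

  isUnitMod⇒periodic : ∀ {q M} .{{_ : NonZero q}} .{{_ : NonZero M}} → q IsUnitMod M → ∃₂ λ t z → q ^ suc t ≡ 1 + M * z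
  isUnitMod⇒periodic {q} {M} unit with pigeonhole (n<1+n M) (λ i → fromℕ< (m%n<n (q ^ toℕ i) M))
  ... | i , j , i<j , same-residue with %-≡⇒≡+* (q ^ toℕ i) (q ^ toℕ j) M residue-eq (^-monoʳ-≤ q (<⇒≤ i<j))
                                      | m≤n⇒∃[o]m+o≡n i<j
    where
    residue-eq : q ^ toℕ i % M ≡ q ^ toℕ j % M
    residue-eq = trans (sym (toℕ-fromℕ< _)) (trans (cong toℕ same-residue) (toℕ-fromℕ< _))
  ... | k , q^j≡q^i+kM | t , 1+i+t≡j = t , quotient M∣q^[1+t]-1 , q^[1+t]≡1+M*quot
    where
    n : ℕ
    n = toℕ i
    q^n[q^[1+t]-1]≡kM : q ^ n * (q ^ suc t ∸ 1) ≡ k * M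
    q^n[q^[1+t]-1]≡kM = begin
      q ^ n * (q ^ suc t ∸ 1)          ≡⟨ *-distribˡ-∸ (q ^ n) (q ^ suc t) 1 ⟩
      q ^ n * q ^ suc t ∸ q ^ n * 1    ≡⟨ cong₂ _∸_ (sym (^-distribˡ-+-* q n (suc t))) (*-identityʳ (q ^ n)) ⟩
      q ^ (n + suc t) ∸ q ^ n          ≡⟨ cong (λ v → q ^ v ∸ q ^ n) (trans (+-suc n t) 1+i+t≡j) ⟩
      q ^ toℕ j ∸ q ^ n                ≡⟨ cong (_∸ q ^ n) q^j≡q^i+kM ⟩
      q ^ n + k * M ∸ q ^ n            ≡⟨ m+n∸m≡n (q ^ n) (k * M) ⟩
      k * M                            ∎
      where open ≡-Reasoning
    M∣q^[1+t]-1 : M ∣ q ^ suc t ∸ 1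
    M∣q^[1+t]-1 = unit n (q ^ suc t ∸ 1) (divides k q^n[q^[1+t]-1]≡kM)
    q^[1+t]≡1+M*quot : q ^ suc t ≡ 1 + M * quotient M∣q^[1+t]-1
    q^[1+t]≡1+M*quot = trans (sym (m+[n∸m]≡n (m^n>0 q (suc t)))) (cong (1 +_) (m∣n⇒n≡m*quotient M∣q^[1+t]-1))

  -- Lifting the exponent

  binomial-tail : ∀ a N → ∃ λ Q → (1 + a) ^ N ≡ 1 + N * a + a * a * Q
  binomial-tail a zero    = 0 , cong suc (sym (*-zeroʳ (a * a)))
  binomial-tail a (suc N) with binomial-tail a N
  ... | Q , eq = Q + N + a * Q , trans (cong ((1 + a) *_) eq) (expand a N Q)
    where
    expand : ∀ a N Q → (1 + a) * (1 + N * a + a * a * Q) ≡ 1 + suc N * a + a * a * (Q + N + a * Q)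
    expand = solve-∀

  [1+M*z]^N : ∀ M z N → ∃ λ z′ → (1 + M * z) ^ N ≡ 1 + M * z′
  [1+M*z]^N M z N with binomial-tail (M * z) N
  ... | Q , eq = N * z + z * (M * z) * Q , trans eq (regroup M z N Q)
    where
    regroup : ∀ M z N Q → 1 + N * (M * z) + M * z * (M * z) * Q ≡ 1 + M * (N * z + z * (M * z) * Q)
    regroup = solve-∀

  [1+r^s*v]^N : ∀ {r s N} → Prime r → 1 ≤ s → ∀ {v} → r ∤ v → r ∤ N →
                     ∃ λ v′ → (1 + r ^ s * v) ^ N ≡ 1 + r ^ s * v′ × r ∤ v′
  [1+r^s*v]^N {r} {suc s} {N} r-prime _ {v} r∤v r∤N with binomial-tail (r ^ suc s * v) N
  ... | Q , eq = N * v + r ^ suc s * (v * v * Q) , trans eq (regroup (r ^ suc s) v N Q) , r∤v′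
    where
    regroup : ∀ S v N Q → 1 + N * (S * v) + S * v * (S * v) * Q ≡ 1 + S * (N * v + S * (v * v * Q))
    regroup = solve-∀
    r∤v′ : r ∤ N * v + r ^ suc s * (v * v * Q)
    r∤v′ r∣v′ = prime-∤-* r-prime r∤N r∤v
      (∣m+n∣m⇒∣n (subst (r ∣_) (+-comm (N * v) _) r∣v′) (∣m⇒∣m*n (v * v * Q) (m∣m*n (r ^ s))))

  [1+M^[1+s]*y]^M^j : ∀ M s y j → ∃ λ y′ → (1 + M ^ suc s * y) ^ (M ^ j) ≡ 1 + M ^ j * M ^ suc s * (y + M ^ s * y′)
  [1+M^[1+s]*y]^M^j M s y zero = 0 , trans (*-identityʳ _) (cong suc (regroup M (M ^ s) y))
    where
    regroup : ∀ M P y → M * P * y ≡ 1 * (M * P) * (y + P * 0)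
    regroup = solve-∀
  [1+M^[1+s]*y]^M^j M s y (suc j) with [1+M^[1+s]*y]^M^j M s y j
  ... | y′ , eq with binomial-tail (M ^ j * M ^ suc s * (y + M ^ s * y′)) M
  ...   | Q , eq′ = y′ + M ^ j * (Y * Y * Q) , (begin
    (1 + M ^ suc s * y) ^ (M * M ^ j)        ≡⟨ cong ((1 + M ^ suc s * y) ^_) (*-comm M (M ^ j)) ⟩
    (1 + M ^ suc s * y) ^ (M ^ j * M)        ≡⟨ sym (^-*-assoc _ (M ^ j) M) ⟩
    ((1 + M ^ suc s * y) ^ (M ^ j)) ^ M      ≡⟨ cong (_^ M) eq ⟩
    (1 + M ^ j * M ^ suc s * Y) ^ M          ≡⟨ eq′ ⟩
    1 + M * (M ^ j * M ^ suc s * Y) + M ^ j * M ^ suc s * Y * (M ^ j * M ^ suc s * Y) * Q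
                                             ≡⟨ regroup M (M ^ j) (M ^ s) y y′ Q ⟩
    1 + M ^ suc j * M ^ suc s * (y + M ^ s * (y′ + M ^ j * (Y * Y * Q))) ∎)
    where
    open ≡-Reasoning
    Y : ℕ
    Y = y + M ^ s * y′
    regroup : ∀ M Mj P y y′ Q →
      1 + M * (Mj * (M * P) * (y + P * y′)) + Mj * (M * P) * (y + P * y′) * (Mj * (M * P) * (y + P * y′)) * Q
      ≡ 1 + M * Mj * (M * P) * (y + P * (y′ + Mj * ((y + P * y′) * (y + P * y′) * Q)))
    regroup = solve-∀

  -- The exponent 2 + s ≥ 2 makes each r-th power raise the valuation by exactly one, also for r = 2.
  [1+r^[2+s]*v]^[N*r^j] : ∀ {r s v N} → Prime r → r ∤ v → r ∤ N → ∀ j →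
                          ∃ λ W → (1 + r ^ (2 + s) * v) ^ (N * r ^ j) ≡ 1 + r ^ j * r ^ (2 + s) * W × r ∤ W
  [1+r^[2+s]*v]^[N*r^j] {r} {s} {v} {N} r-prime r∤v r∤N j
    with [1+r^s*v]^N {s = 2 + s} {N = N} r-prime (s≤s z≤n) r∤v r∤N
  ... | v₁ , eq₁ , r∤v₁ with [1+M^[1+s]*y]^M^j r (suc s) v₁ j
  ...   | v₂ , eq₂ = v₁ + r ^ suc s * v₂ ,
                     trans (sym (^-*-assoc _ N (r ^ j))) (trans (cong (_^ (r ^ j)) eq₁) eq₂) ,
                     λ r∣ → r∤v₁ (∣m+n∣m⇒∣n (subst (r ∣_) (+-comm v₁ _) r∣) (∣m⇒∣m*n v₂ (∣m⇒∣m*n (r ^ s) (∣-refl {r}))))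

  [1+L*y]^[L^e*k] : ∀ L y e k → ∃ λ z → (1 + L * y) ^ (L ^ e * k) ≡ 1 + L ^ e * z
  [1+L*y]^[L^e*k] L y e k with [1+M^[1+s]*y]^M^j L 0 y e
  ... | y₁ , eq₁ with [1+M*z]^N (L ^ e) (L ^ 1 * (y + 1 * y₁)) k
  ...   | z , eq₂ = z , (begin
    (1 + L * y) ^ (L ^ e * k)             ≡⟨ sym (^-*-assoc _ (L ^ e) k) ⟩
    ((1 + L * y) ^ (L ^ e)) ^ k           ≡⟨ cong (λ u → ((1 + u * y) ^ (L ^ e)) ^ k) (sym (*-identityʳ L)) ⟩
    ((1 + L ^ 1 * y) ^ (L ^ e)) ^ k       ≡⟨ cong (_^ k) (trans eq₁ (cong suc (*-assoc (L ^ e) (L ^ 1) _))) ⟩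
    (1 + L ^ e * (L ^ 1 * (y + 1 * y₁))) ^ k ≡⟨ eq₂ ⟩
    1 + L ^ e * z                         ∎)
    where open ≡-Reasoning

  exact-valuation-period : ∀ {L} .{{_ : NonZero q}} .{{_ : NonZero L}} → 2 ≤ q → Prime r → r ∤ q → q IsUnitMod L → r ∤ L →
    ∃₂ λ b t → ∃₂ λ v y → q ^ suc t ≡ 1 + r ^ (2 + b) * v × r ∤ v × q ^ suc t ≡ 1 + L * y
  exact-valuation-period {q} {r} {L} 2≤q r-prime r∤q unitL r∤L = split-valuation period-mod-r²L
    where
    instance
      r≢0 : NonZero r
      r≢0 = prime⇒nonZero r-prime
      r²≢0 : NonZero (r ^ 2)
      r²≢0 = m^n≢0 r 2
      r²L≢0 : NonZero (r ^ 2 * L)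
      r²L≢0 = m*n≢0 (r ^ 2) L
    period-mod-r²L : ∃₂ λ t z → q ^ suc t ≡ 1 + r ^ 2 * L * z
    period-mod-r²L = isUnitMod⇒periodic (isUnitMod-* (isUnitMod-^ (prime∤⇒isUnitMod r-prime r∤q) 2) unitL)
    regroup : ∀ R L B v → R * L * (B * v) ≡ R * B * (L * v)
    regroup = solve-∀
    regroup′ : ∀ R L B v → R * L * (B * v) ≡ L * (R * B * v)
    regroup′ = solve-∀
    split-valuation : (∃₂ λ t z → q ^ suc t ≡ 1 + r ^ 2 * L * z) →
                      ∃₂ λ b t → ∃₂ λ v y → q ^ suc t ≡ 1 + r ^ (2 + b) * v × r ∤ v × q ^ suc t ≡ 1 + L * y
    split-valuation (t , z , q^t≡1+r²Lz) with prime-power-factor r-prime 0<z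
      where
      0<z : 0 < z
      0<z = m*n>0⇒n>0 (r ^ 2 * L) z (s≤s⁻¹ (subst (1 <_) q^t≡1+r²Lz
              (≤-trans 2≤q (m≤m*n q (q ^ t) {{m^n≢0 q t}}))))
    ... | b , v , refl , r∤v =
      b , t , L * v , r ^ 2 * r ^ b * v ,
      trans q^t≡1+r²Lz (cong suc (trans (regroup (r ^ 2) L (r ^ b) v) (cong (_* (L * v)) (sym (^-distribˡ-+-* r 2 b))))) ,
      prime-∤-* r-prime r∤L r∤v ,
      trans q^t≡1+r²Lz (cong suc (regroup′ (r ^ 2) L (r ^ b) v))

  lift-exact-valuation : ∀ {q r L t b v y} .{{_ : NonZero L}} → Prime r → r ∤ L →
    q ^ t ≡ 1 + r ^ (2 + b) * v → r ∤ v → q ^ t ≡ 1 + L * y →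
    ∀ e h → 2 + b ≤ h → ∃₂ λ T w → q ^ T ≡ 1 + r ^ h * L ^ e * w × r ∤ w
  lift-exact-valuation {q} {r} {L} {t} {b} {v} {y} r-prime r∤L q^t≡1+r^s₀v r∤v q^t≡1+Ly e h s₀≤h
    with [1+r^[2+s]*v]^[N*r^j] {s = b} r-prime r∤v (prime-∤-^ r-prime r∤L e) (h ∸ (2 + b))
       | [1+L*y]^[L^e*k] L y e (r ^ (h ∸ (2 + b)))
  ... | W , r-part , r∤W | z , L-part = T , w , (begin
      q ^ T                          ≡⟨ q^T≡1+r^h*W ⟩
      1 + r ^ h * W                  ≡⟨ cong (λ u → 1 + r ^ h * u) (m∣n⇒n≡quotient*m L^e∣W) ⟩
      1 + r ^ h * (w * L ^ e)        ≡⟨ cong suc (regroup (r ^ h) w (L ^ e)) ⟩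
      1 + r ^ h * L ^ e * w          ∎) ,
      λ r∣w → r∤W (subst (r ∣_) (sym (m∣n⇒n≡quotient*m L^e∣W)) (∣m⇒∣m*n (L ^ e) r∣w))
    where
    open ≡-Reasoning
    j T : ℕ
    j = h ∸ (2 + b)
    T = t * (L ^ e * r ^ j)
    regroup : ∀ a b c → a * (b * c) ≡ a * c * b
    regroup = solve-∀
    q^T≡1+r^h*W : q ^ T ≡ 1 + r ^ h * W
    q^T≡1+r^h*W = trans (sym (^-*-assoc q t (L ^ e * r ^ j))) (trans (cong (_^ (L ^ e * r ^ j)) q^t≡1+r^s₀v)
                  (trans r-part (cong (λ u → 1 + u * W) (trans (sym (^-distribˡ-+-* r j (2 + b))) (cong (r ^_) (m∸n+n≡m s₀≤h))))))
    q^T≡1+L^e*z : q ^ T ≡ 1 + L ^ e * z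
    q^T≡1+L^e*z = trans (sym (^-*-assoc q t (L ^ e * r ^ j))) (trans (cong (_^ (L ^ e * r ^ j)) q^t≡1+Ly) L-part)
    L^e∣W : L ^ e ∣ W
    L^e∣W = isUnitMod-^ (coprime⇒isUnitMod (prime∤⇒coprime r-prime r∤L)) e h W
              (divides z (trans (suc-injective (trans (sym q^T≡1+r^h*W) q^T≡1+L^e*z)) (*-comm (L ^ e) z)))
    w : ℕ
    w = quotient L^e∣W

  lift-exponent : ∀ {L} .{{_ : NonZero q}} .{{_ : NonZero L}} → 2 ≤ q → Prime r → r ∤ q → q IsUnitMod L → r ∤ L →
    ∃ λ s₀ → ∀ e h → s₀ ≤ h → ∃₂ λ T w → q ^ T ≡ 1 + r ^ h * L ^ e * w × r ∤ w
  lift-exponent 2≤q r-prime r∤q unitL r∤L =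
    let b , t , v , y , q^t≡1+r^s₀v , r∤v , q^t≡1+Ly = exact-valuation-period 2≤q r-prime r∤q unitL r∤L
    in  2 + b , lift-exact-valuation {t = suc t} {b} {v} {y} r-prime r∤L q^t≡1+r^s₀v r∤v q^t≡1+Ly

  -- Forced digits

  record StrictDigit (q m A D : ℕ) : Set where
    constructor strictDigit
    field
      n N   : ℕ
      above : (q * N + m) * D < q ^ suc n * A
      below : q ^ suc n * A < (q * N + m + 1) * D

  strictDigit-cong : ∀ {m A D A′ D′} .{{_ : NonZero D′}} → A * D′ ≡ A′ * D →
                     StrictDigit q m A D → StrictDigit q m A′ D′
  strictDigit-cong {q} {m} {A} {D} {A′} {D′} AD′≡A′D (strictDigit n N lower upper) =
    strictDigit n N
      (*-cancelʳ-< D _ _ (subst₂ _<_ (exchange (q * N + m)) (cross (q ^ suc n)) (*-monoˡ-< D′ lower)))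
      (*-cancelʳ-< D _ _ (subst₂ _<_ (cross (q ^ suc n)) (exchange (q * N + m + 1)) (*-monoˡ-< D′ upper)))
    where
    exchange : ∀ x → x * D * D′ ≡ x * D′ * D
    exchange x = trans (*-assoc x D D′) (trans (cong (x *_) (*-comm D D′)) (sym (*-assoc x D′ D)))
    cross : ∀ Q → Q * A * D′ ≡ Q * A′ * D
    cross Q = trans (*-assoc Q A D′) (trans (cong (Q *_) AD′≡A′D) (sym (*-assoc Q A′ D)))

  strictDigit-unshift : ∀ {m A D} t → StrictDigit q m (q ^ t * A) D → StrictDigit q m A D
  strictDigit-unshift {q} {m} {A} {D} t (strictDigit n N lower upper) =
    strictDigit (n + t) N (subst ((q * N + m) * D <_) shift lower) (subst (_< (q * N + m + 1) * D) shift upper)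
    where
    shift : q ^ suc n * (q ^ t * A) ≡ q ^ suc (n + t) * A
    shift = trans (sym (*-assoc (q ^ suc n) (q ^ t) A)) (cong (_* A) (sym (^-distribˡ-+-* q (suc n) t)))

  progression-hits : ∀ b T D .{{_ : NonZero D}} → b ≤ T → ∃ λ k → T < b + k * D × b + k * D ≤ T + D
  progression-hits b T D b≤T = suc (X / D) , lower , upper
    where
    open ≤-Reasoning
    X : ℕ
    X = T ∸ b
    lower : T < b + (D + X / D * D)
    lower = begin-strict
      T                          ≡⟨ sym (m+[n∸m]≡n b≤T) ⟩
      b + X                      ≡⟨ cong (b +_) (m≡m%n+[m/n]*n X D) ⟩
      b + (X % D + X / D * D)    <⟨ +-monoʳ-< b (+-monoˡ-< (X / D * D) (m%n<n X D)) ⟩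
      b + (D + X / D * D)        ∎
    upper : b + (D + X / D * D) ≤ T + D
    upper = begin
      b + (D + X / D * D)        ≤⟨ +-monoʳ-≤ b (+-monoʳ-≤ D (m/n*n≤m X D)) ⟩
      b + (D + X)                ≡⟨ trans (cong (b +_) (+-comm D X)) (sym (+-assoc b X D)) ⟩
      b + X + D                  ≡⟨ cong (_+ D) (m+[n∸m]≡n b≤T) ⟩
      T + D                      ∎

  orbit-hits-residues : ∀ {q c w T M R t u} → q ^ T ≡ 1 + M * w → R ∣ M → (c * w) ^ suc t ≡ 1 + R * u →
                        ∀ k → ∃₂ λ n Z → q ^ n * c ≡ c + k * M + R * M * Z
  orbit-hits-residues {q} {c} {w} {T} {_} {R} {t} {u} q^T≡1+Mw (divides M′ refl) cw-inverse k
    with binomial-tail (M′ * R * w) (k * (c * w) ^ t)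
  ... | Q , expansion = T * i , k * u + M′ * (w * w * Q * c) , (begin
    q ^ (T * i) * c                                    ≡⟨ cong (_* c) (sym (^-*-assoc q T i)) ⟩
    (q ^ T) ^ i * c                                    ≡⟨ cong (λ x → x ^ i * c) q^T≡1+Mw ⟩
    (1 + M′ * R * w) ^ i * c                           ≡⟨ cong (_* c) expansion ⟩
    (1 + i * (M′ * R * w) + M′ * R * w * (M′ * R * w) * Q) * c
                                                       ≡⟨ regroup k A M′ R w Q c ⟩
    c + k * (M′ * R) * (c * w * A) + M′ * R * (M′ * R) * (w * w * Q * c)
                                                       ≡⟨ cong (λ x → c + k * (M′ * R) * x + M′ * R * (M′ * R) * (w * w * Q * c)) cw-inverse ⟩
    c + k * (M′ * R) * (1 + R * u) + M′ * R * (M′ * R) * (w * w * Q * c)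
                                                       ≡⟨ regroup′ k M′ R u (w * w * Q * c) c ⟩
    c + k * (M′ * R) + R * (M′ * R) * (k * u + M′ * (w * w * Q * c)) ∎)
    where
    open ≡-Reasoning
    A i : ℕ
    A = (c * w) ^ t
    i = k * A
    regroup : ∀ k A M′ R w Q c → (1 + k * A * (M′ * R * w) + M′ * R * w * (M′ * R * w) * Q) * c
                               ≡ c + k * (M′ * R) * (c * w * A) + M′ * R * (M′ * R) * (w * w * Q * c)
    regroup = solve-∀
    regroup′ : ∀ k M′ R u W c → c + k * (M′ * R) * (1 + R * u) + M′ * R * (M′ * R) * W
                              ≡ c + k * (M′ * R) + R * (M′ * R) * (k * u + M′ * W)
    regroup′ = solve-∀

  strictDigit-of-orbit : ∀ {m c R M} .{{_ : NonZero q}} .{{_ : NonZero M}} → q < R →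
    (∀ k → ∃₂ λ n Z → q ^ n * c ≡ c + k * M + R * M * Z) → StrictDigit q m c (R * M)
  strictDigit-of-orbit {q} {m} {c} {R} {M} q<R orbit = hit (progression-hits (q * c) T (q * M) qc≤T)
    where
    instance
      qM≢0 : NonZero (q * M)
      qM≢0 = m*n≢0 q M
      RM≢0 : NonZero (R * M)
      RM≢0 = m*n≢0 R M {{>-nonZero (≤-<-trans z≤n q<R)}}
    T : ℕ
    T = (q * c + m) * (R * M)
    qc≤T : q * c ≤ T
    qc≤T = ≤-trans (m≤m+n (q * c) m) (m≤m*n (q * c + m) (R * M))
    hit : (∃ λ k → T < q * c + k * (q * M) × q * c + k * (q * M) ≤ T + q * M) → StrictDigit q m c (R * M)
    hit (k , T<P , P≤T+qM) = strictDigit n (c + Z) lower upper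
      where
      open ≤-Reasoning
      n Z P S : ℕ
      n = proj₁ (orbit k)
      Z = proj₁ (proj₂ (orbit k))
      P = q * c + k * (q * M)
      S = q * Z * (R * M)
      q^[1+n]c≡P+S : q ^ suc n * c ≡ P + S
      q^[1+n]c≡P+S = trans (*-assoc q (q ^ n) c) (trans (cong (q *_) (proj₂ (proj₂ (orbit k)))) (regroup q c k M R Z))
        where
        regroup : ∀ q c k M R Z → q * (c + k * M + R * M * Z) ≡ q * c + k * (q * M) + q * Z * (R * M)
        regroup = solve-∀
      lower : (q * (c + Z) + m) * (R * M) < q ^ suc n * c
      lower = begin-strict
        (q * (c + Z) + m) * (R * M) ≡⟨ regroup q c Z m (R * M) ⟩
        T + S                       <⟨ +-monoˡ-< S T<P ⟩
        P + S                       ≡⟨ sym q^[1+n]c≡P+S ⟩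
        q ^ suc n * c               ∎
        where
        regroup : ∀ q c Z m D → (q * (c + Z) + m) * D ≡ (q * c + m) * D + q * Z * D
        regroup = solve-∀
      upper : q ^ suc n * c < (q * (c + Z) + m + 1) * (R * M)
      upper = begin-strict
        q ^ suc n * c               ≡⟨ q^[1+n]c≡P+S ⟩
        P + S                       ≤⟨ +-monoˡ-≤ S P≤T+qM ⟩
        T + q * M + S               <⟨ +-monoˡ-< S (+-monoʳ-< T (*-monoˡ-< M q<R)) ⟩
        T + R * M + S               ≡⟨ regroup q c Z m R M ⟩
        (q * (c + Z) + m + 1) * (R * M) ∎
        where
        regroup : ∀ q c Z m R M → (q * c + m) * (R * M) + R * M + q * Z * (R * M) ≡ (q * (c + Z) + m + 1) * (R * M)
        regroup = solve-∀

  strictDigit-of-unit-step : ∀ {q r G M T w c m} .{{_ : NonZero q}} .{{_ : NonZero M}} → Prime r → q < r ^ G →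
    r ^ G ∣ M → q ^ T ≡ 1 + M * w → r ∤ w → r ∤ c → StrictDigit q m c (r ^ G * M)
  strictDigit-of-unit-step {q} {r} {G} {M} {T} {w} {c} r-prime q<r^G r^G∣M q^T≡1+Mw r∤w r∤c =
    strictDigit-of-orbit q<r^G (orbit-hits-residues {T = T} {t = proj₁ period} q^T≡1+Mw r^G∣M (proj₂ (proj₂ period)))
    where
    r∤cw : r ∤ c * w
    r∤cw = prime-∤-* r-prime r∤c r∤w
    instance
      r≢0 : NonZero r
      r≢0 = prime⇒nonZero r-prime
      cw≢0 : NonZero (c * w)
      cw≢0 = ≢-nonZero λ cw≡0 → r∤cw (subst (r ∣_) (sym cw≡0) (r ∣0))
      r^G≢0 : NonZero (r ^ G)
      r^G≢0 = m^n≢0 r G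
    period : ∃₂ λ t u → (c * w) ^ suc t ≡ 1 + r ^ G * u
    period = isUnitMod⇒periodic (isUnitMod-^ (prime∤⇒isUnitMod r-prime r∤cw) G)

  strictDigit-of-large-prime-power : ∀ {L} .{{_ : NonZero q}} .{{_ : NonZero L}} → 2 ≤ q → Prime r → r ∤ q →
    q IsUnitMod L → r ∤ L → ∃ λ E₀ → ∀ {m} E → E₀ ≤ E → ∀ e c → r ∤ c → StrictDigit q m c (r ^ E * L ^ e)
  strictDigit-of-large-prime-power {q} {r} {L} 2≤q r-prime r∤q unitL r∤L =
    let s₀ , lift = lift-exponent 2≤q r-prime r∤q unitL r∤L in (q + s₀) + q , hit s₀ lift
    where
    instance
      r≢0 : NonZero r
      r≢0 = prime⇒nonZero r-prime
    q<r^q : q < r ^ q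
    q<r^q = <-≤-trans (n<2^n q) (^-monoˡ-≤ q (prime⇒2≤ r-prime))
    hit : ∀ s₀ → (∀ e h → s₀ ≤ h → ∃₂ λ T w → q ^ T ≡ 1 + r ^ h * L ^ e * w × r ∤ w) →
          ∀ {m} E → (q + s₀) + q ≤ E → ∀ e c → r ∤ c → StrictDigit q m c (r ^ E * L ^ e)
    hit s₀ lift {m} E E₀≤E e c r∤c =
      let T , w , q^T≡1+Mw , r∤w = lift e h (m+n≤o⇒n≤o q q+s₀≤h)
      in  subst (StrictDigit q m c) r^q*M≡r^E*L^e (strictDigit-of-unit-step {G = q} {T = T} r-prime q<r^q r^q∣M q^T≡1+Mw r∤w r∤c)
      where
      h M : ℕ
      h = E ∸ q
      M = r ^ h * L ^ e
      q+s₀≤h : q + s₀ ≤ h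
      q+s₀≤h = m+n≤o⇒m≤o∸n (q + s₀) E₀≤E
      instance
        M≢0 : NonZero M
        M≢0 = m*n≢0 (r ^ h) (L ^ e) {{m^n≢0 r h}} {{m^n≢0 L e}}
      r^q∣M : r ^ q ∣ M
      r^q∣M = ∣m⇒∣m*n (L ^ e) (^-monoʳ-∣ r (m+n≤o⇒m≤o q q+s₀≤h))
      r^q*M≡r^E*L^e : r ^ q * M ≡ r ^ E * L ^ e
      r^q*M≡r^E*L^e = trans (sym (*-assoc (r ^ q) (r ^ h) (L ^ e)))
        (cong (_* L ^ e) (trans (sym (^-distribˡ-+-* r q h)) (cong (r ^_) (m+[n∸m]≡n (≤-trans (m≤n+m q (q + s₀)) E₀≤E)))))

  -- With c = A′·s′·u^e one has c·D = q^(t·e)·A·r^E·L₂^e, so A/D is c/(r^E·L₂^e) shifted by t·e digits.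
  strictDigit-transfer : ∀ {q m r A D s L₁ L₂ u t} .{{_ : NonZero D}} .{{_ : NonZero s}} → ∀ e E a₀ σ A′ s′ →
    A ≡ r ^ a₀ * A′ → s ≡ r ^ σ * s′ → L₁ * u ≡ q ^ t → D * s ≡ r ^ (E + (a₀ + σ)) * (L₁ ^ e * L₂ ^ e) →
    StrictDigit q m (A′ * s′ * u ^ e) (r ^ E * L₂ ^ e) → StrictDigit q m A D
  strictDigit-transfer {q} {m} {r} {A} {D} {s} {L₁} {L₂} {u} {t} e E a₀ σ A′ s′ A≡ s≡ L₁u≡q^t Ds≡ =
    strictDigit-unshift (t * e) ∘ strictDigit-cong cross
    where
    open ≡-Reasoning
    c : ℕ
    c = A′ * s′ * u ^ e
    regroup : ∀ A′ s′ U RE Ra Rσ L₁ L₂ → A′ * s′ * U * (RE * (Ra * Rσ) * (L₁ * L₂)) ≡ L₁ * U * (Ra * A′) * (RE * L₂) * (Rσ * s′)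
    regroup = solve-∀
    L₁^e*u^e≡q^te : L₁ ^ e * u ^ e ≡ q ^ (t * e)
    L₁^e*u^e≡q^te = trans (sym (^-distribʳ-* L₁ u e)) (trans (cong (_^ e) L₁u≡q^t) (^-*-assoc q t e))
    cross : c * D ≡ q ^ (t * e) * A * (r ^ E * L₂ ^ e)
    cross = *-cancelʳ-≡ _ _ s (begin
      c * D * s                                                ≡⟨ *-assoc c D s ⟩
      c * (D * s)                                              ≡⟨ cong (c *_) Ds≡ ⟩
      c * (r ^ (E + (a₀ + σ)) * (L₁ ^ e * L₂ ^ e))             ≡⟨ cong (λ x → c * (x * (L₁ ^ e * L₂ ^ e))) r^[E+a₀+σ]≡ ⟩
      c * (r ^ E * (r ^ a₀ * r ^ σ) * (L₁ ^ e * L₂ ^ e))       ≡⟨ regroup A′ s′ (u ^ e) (r ^ E) (r ^ a₀) (r ^ σ) (L₁ ^ e) (L₂ ^ e) ⟩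
      L₁ ^ e * u ^ e * (r ^ a₀ * A′) * (r ^ E * L₂ ^ e) * (r ^ σ * s′)
                                                               ≡⟨ cong₂ (λ x y → x * y * (r ^ E * L₂ ^ e) * (r ^ σ * s′)) L₁^e*u^e≡q^te (sym A≡) ⟩
      q ^ (t * e) * A * (r ^ E * L₂ ^ e) * (r ^ σ * s′)        ≡⟨ cong (q ^ (t * e) * A * (r ^ E * L₂ ^ e) *_) (sym s≡) ⟩
      q ^ (t * e) * A * (r ^ E * L₂ ^ e) * s                   ∎)
      where
      r^[E+a₀+σ]≡ : r ^ (E + (a₀ + σ)) ≡ r ^ E * (r ^ a₀ * r ^ σ)
      r^[E+a₀+σ]≡ = trans (^-distribˡ-+-* r E (a₀ + σ)) (cong (r ^ E *_) (^-distribˡ-+-* r a₀ σ))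

  strictDigit-of-split-denominator :
    ∀ {q r A a L₁ L₂ t u} .{{_ : NonZero q}} .{{_ : NonZero A}} .{{_ : NonZero L₂}} →
    2 ≤ q → Prime r → r ∤ q → Coprime L₂ q → r ∤ L₂ → L₁ * u ≡ q ^ t →
    ∃ λ K → ∀ {m} e D s → D * s ≡ (r ^ a * (L₁ * L₂)) ^ e → r ^ K ∣ D → StrictDigit q m A D
  strictDigit-of-split-denominator {q} {r} {A} {a} {L₁} {L₂} {t} {u} 2≤q r-prime r∤q L₂⊥q r∤L₂ L₁u≡q^t =
    let E₀ , large = strictDigit-of-large-prime-power 2≤q r-prime r∤q (coprime⇒isUnitMod L₂⊥q) r∤L₂
        a₀ , A′ , A≡ , r∤A′ = prime-power-factor r-prime (>-nonZero⁻¹ A)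
    in  E₀ + a₀ , hit E₀ large a₀ A′ A≡ r∤A′
    where
    r∤L₁ : r ∤ L₁
    r∤L₁ = prime-∤-∣^ {t = t} r-prime r∤q (divides u (trans (sym L₁u≡q^t) (*-comm L₁ u)))
    r∤u : r ∤ u
    r∤u = prime-∤-∣^ {t = t} r-prime r∤q (divides L₁ (sym L₁u≡q^t))
    instance
      r≢0 : NonZero r
      r≢0 = prime⇒nonZero r-prime
      L₁≢0 : NonZero L₁
      L₁≢0 = ≢-nonZero λ L₁≡0 → ≢-nonZero⁻¹ (q ^ t) {{m^n≢0 q t}} (trans (sym L₁u≡q^t) (cong (_* u) L₁≡0))
    L^e≡ : ∀ e → (r ^ a * (L₁ * L₂)) ^ e ≡ r ^ (a * e) * (L₁ ^ e * L₂ ^ e)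
    L^e≡ e = begin
      (r ^ a * (L₁ * L₂)) ^ e           ≡⟨ ^-distribʳ-* (r ^ a) (L₁ * L₂) e ⟩
      (r ^ a) ^ e * (L₁ * L₂) ^ e       ≡⟨ cong₂ _*_ (^-*-assoc r a e) (^-distribʳ-* L₁ L₂ e) ⟩
      r ^ (a * e) * (L₁ ^ e * L₂ ^ e)   ∎
      where open ≡-Reasoning
    hit : ∀ E₀ → (∀ {m} E → E₀ ≤ E → ∀ e c → r ∤ c → StrictDigit q m c (r ^ E * L₂ ^ e)) →
          ∀ a₀ A′ → A ≡ r ^ a₀ * A′ → r ∤ A′ →
          ∀ {m} e D s → D * s ≡ (r ^ a * (L₁ * L₂)) ^ e → r ^ (E₀ + a₀) ∣ D → StrictDigit q m A D
    hit E₀ large a₀ A′ A≡ r∤A′ {m} e D s Ds≡L^e r^K∣D =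
      let σ , s′ , s≡ , r∤s′ = prime-power-factor r-prime (>-nonZero⁻¹ s)
          K+σ≤ae : E₀ + a₀ + σ ≤ a * e
          K+σ≤ae = prime-power-∣⇒≤ r-prime
                     (subst₂ _∣_ (sym (^-distribˡ-+-* r (E₀ + a₀) σ)) (trans Ds≡L^e (L^e≡ e))
                       (*-pres-∣ r^K∣D (subst (r ^ σ ∣_) (sym s≡) (m∣m*n s′))))
                     (prime-∤-* r-prime (prime-∤-^ r-prime r∤L₁ e) (prime-∤-^ r-prime r∤L₂ e))
          E₀+[a₀+σ]≤ae : E₀ + (a₀ + σ) ≤ a * e
          E₀+[a₀+σ]≤ae = subst (_≤ a * e) (+-assoc E₀ a₀ σ) K+σ≤ae
          E : ℕ
          E = a * e ∸ (a₀ + σ)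
      in  strictDigit-transfer {t = t} e E a₀ σ A′ s′ A≡ s≡ L₁u≡q^t
            (trans Ds≡L^e (trans (L^e≡ e) (cong (λ x → r ^ x * (L₁ ^ e * L₂ ^ e)) (sym (m∸n+n≡m (m+n≤o⇒n≤o E₀ E₀+[a₀+σ]≤ae))))))
            (large E (m+n≤o⇒m≤o∸n E₀ E₀+[a₀+σ]≤ae) e _
              (prime-∤-* r-prime (prime-∤-* r-prime r∤A′ r∤s′) (prime-∤-^ r-prime r∤u e)))
      where
      Ds≢0 : D * s ≢ 0
      Ds≢0 Ds≡0 = ≢-nonZero⁻¹ _ {{m^n≢0 _ e {{m*n≢0 (r ^ a) (L₁ * L₂) {{m^n≢0 r a}} {{m*n≢0 L₁ L₂}}}}}} (trans (sym Ds≡L^e) Ds≡0)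
      instance
        D≢0 : NonZero D
        D≢0 = ≢-nonZero λ D≡0 → Ds≢0 (cong (_* s) D≡0)
        s≢0 : NonZero s
        s≢0 = ≢-nonZero λ s≡0 → Ds≢0 (trans (cong (D *_) s≡0) (*-zeroʳ D))

  factor-denominator : ∀ {q r L} → Prime r → 0 < L →
    ∃₂ λ a L₁ → ∃₂ λ L₂ t → ∃ λ u → L ≡ r ^ a * (L₁ * L₂) × L₁ * u ≡ q ^ t × Coprime L₂ q × r ∤ L₂ × 0 < L₂
  factor-denominator {q} {r} {L} r-prime 0<L = split (prime-power-factor r-prime 0<L)
    where
    split : (∃₂ λ a L″ → L ≡ r ^ a * L″ × r ∤ L″) →
            ∃₂ λ a L₁ → ∃₂ λ L₂ t → ∃ λ u → L ≡ r ^ a * (L₁ * L₂) × L₁ * u ≡ q ^ t × Coprime L₂ q × r ∤ L₂ × 0 < L₂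
    split (a , L″ , refl , r∤L″) with smooth-coprime-split q (m*n>0⇒n>0 (r ^ a) L″ 0<L)
    ... | L₁ , L₂ , t , refl , divides u q^t≡uL₁ , L₂⊥q =
      a , L₁ , L₂ , t , u , refl , trans (*-comm L₁ u) (sym q^t≡uL₁) , L₂⊥q ,
      (λ r∣L₂ → r∤L″ (∣n⇒∣m*n L₁ r∣L₂)) , m*n>0⇒n>0 L₁ L₂ (m*n>0⇒n>0 (r ^ a) (L₁ * L₂) 0<L)

  strictDigit-of-divisor-of-power : ∀ {q r A L} .{{_ : NonZero q}} .{{_ : NonZero A}} → 2 ≤ q → Prime r → r ∤ q → 0 < L →
    ∃ λ K → ∀ {m} e D s → D * s ≡ L ^ e → r ^ K ∣ D → StrictDigit q m A D
  strictDigit-of-divisor-of-power {q} {r} {A} {L} 2≤q r-prime r∤q 0<L with factor-denominator {q} r-prime 0<L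
  ... | a , L₁ , L₂ , t , u , refl , L₁u≡q^t , L₂⊥q , r∤L₂ , 0<L₂ =
    strictDigit-of-split-denominator {a = a} {L₁} {L₂} {t} {u} 2≤q r-prime r∤q L₂⊥q r∤L₂ L₁u≡q^t
    where
    instance
      L₂≢0 : NonZero L₂
      L₂≢0 = >-nonZero 0<L₂

  product : ∀ {ℓ} → Vec ℕ ℓ → ℕ
  product []       = 1
  product (p ∷ ps) = p * product ps

  product>0 : ∀ {ℓ} (ps : Vec ℕ ℓ) → (∀ j → 0 < lookup ps j) → 0 < product ps
  product>0 []       _      = z<s
  product>0 (p ∷ ps) ps>0 = *-mono-≤ (ps>0 zero) (product>0 ps (ps>0 ∘ suc))

  prodPow>0 : ∀ {ℓ} (ps ks : Vec ℕ ℓ) → (∀ j → 0 < lookup ps j) → 0 < prodPow ps ks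
  prodPow>0 []       []       _    = z<s
  prodPow>0 (p ∷ ps) (k ∷ ks) ps>0 = *-mono-≤ (m^n>0 p {{>-nonZero (ps>0 zero)}} k) (prodPow>0 ps ks (ps>0 ∘ suc))

  prodPow∣product^sum : ∀ {ℓ} (ps ks : Vec ℕ ℓ) → prodPow ps ks ∣ product ps ^ sum ks
  prodPow∣product^sum []       []       = ∣-refl
  prodPow∣product^sum (p ∷ ps) (k ∷ ks) =
    subst (p ^ k * prodPow ps ks ∣_) (sym (^-distribʳ-* p (product ps) (k + sum ks)))
      (*-pres-∣ (^-monoʳ-∣ p (m≤m+n k (sum ks)))
                (∣-trans (prodPow∣product^sum ps ks) (^-monoʳ-∣ (product ps) (m≤n+m (sum ks) k))))

  lookup^lookup∣prodPow : ∀ {ℓ} (ps ks : Vec ℕ ℓ) j → lookup ps j ^ lookup ks j ∣ prodPow ps ks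
  lookup^lookup∣prodPow (p ∷ ps) (k ∷ ks) zero    = m∣m*n (prodPow ps ks)
  lookup^lookup∣prodPow (p ∷ ps) (k ∷ ks) (suc j) = ∣n⇒∣m*n (p ^ k) (lookup^lookup∣prodPow ps ks j)

  strictDigit-of-large-exponent : ∀ {q ℓ A B r} .{{_ : NonZero q}} .{{_ : NonZero A}} → 2 ≤ q → 0 < B →
    (ps : Vec ℕ ℓ) → (∀ j → 0 < lookup ps j) → (j : Fin ℓ) → Prime r → r ∣ lookup ps j → r ∤ q →
    ∃ λ K → ∀ {m} ks → K ≤ lookup ks j → StrictDigit q m A (B * prodPow ps ks)
  strictDigit-of-large-exponent {q} {ℓ} {A} {B} {r} 2≤q 0<B ps ps>0 j r-prime r∣p r∤q =
    let K , hit = strictDigit-of-divisor-of-power 2≤q r-prime r∤q (*-mono-≤ 0<B (product>0 ps ps>0))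
    in  K , λ ks K≤k → hit (suc (sum ks)) (B * prodPow ps ks) _ (sym (m∣n⇒n≡m*quotient (D∣L^e ks))) (r^K∣D K≤k)
    where
    L : ℕ
    L = B * product ps
    D∣L^e : ∀ ks → B * prodPow ps ks ∣ L ^ suc (sum ks)
    D∣L^e ks = *-pres-∣ (m∣m*n {B} (product ps)) (∣-trans (prodPow∣product^sum ps ks) (^-monoˡ-∣ (n∣m*n B) (sum ks)))
    r^K∣D : ∀ {K ks} → K ≤ lookup ks j → r ^ K ∣ B * prodPow ps ks
    r^K∣D {K} {ks} K≤k = ∣n⇒∣m*n B (∣-trans (^-monoʳ-∣ r K≤k)
                           (∣-trans (^-monoˡ-∣ r∣p (lookup ks j)) (lookup^lookup∣prodPow ps ks j)))

  -- Digits of a convergent expansion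

  digitPrefix : (q : ℕ) → (ℕ → Fin q) → ℕ → ℕ
  digitPrefix q d zero    = 0
  digitPrefix q d (suc n) = q * digitPrefix q d n + toℕ (d n)

  digitPrefix-+ : ∀ q d a k → ∃ λ R → digitPrefix q d (a + k) ≡ digitPrefix q d a * q ^ k + R × R < q ^ k
  digitPrefix-+ q d a zero    = 0 , trans (cong (digitPrefix q d) (+-identityʳ a)) (sym (trans (+-identityʳ _) (*-identityʳ _))) , z<s
  digitPrefix-+ q d a (suc k) with digitPrefix-+ q d a k
  ... | R , split , R<q^k = q * R + toℕ (d (a + k)) ,
    trans (cong (digitPrefix q d) (+-suc a k)) (trans (cong (λ x → q * x + toℕ (d (a + k))) split) (regroup q (digitPrefix q d a) (q ^ k) R _)) ,
    (begin-strict
      q * R + toℕ (d (a + k)) <⟨ +-monoʳ-< (q * R) (toℕ<n (d (a + k))) ⟩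
      q * R + q               ≡⟨ trans (+-comm (q * R) q) (sym (*-suc q R)) ⟩
      q * suc R               ≤⟨ *-monoʳ-≤ q R<q^k ⟩
      q * q ^ k               ∎)
    where
    open ≤-Reasoning
    regroup : ∀ q Z Q R t → q * (Z * Q + R) + t ≡ Z * (q * Q) + (q * R + t)
    regroup = solve-∀

  digit-unique : ∀ q {u v a b} → a < q → b < q → q * u + a ≡ q * v + b → a ≡ b
  digit-unique q {u} {v} {a} {b} a<q b<q eq = begin
    a                    ≡⟨ sym (m<n⇒m%n≡m a<q) ⟩
    a % q                ≡⟨ sym ([m+kn]%n≡m%n a u q) ⟩
    (a + u * q) % q      ≡⟨ cong (_% q) (trans (comm q u a) (trans eq (sym (comm q v b)))) ⟩
    (b + v * q) % q      ≡⟨ [m+kn]%n≡m%n b v q ⟩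
    b % q                ≡⟨ m<n⇒m%n≡m b<q ⟩
    b                    ∎
    where
    instance
      q≢0 : NonZero q
      q≢0 = >-nonZero (≤-<-trans z≤n a<q)
    open ≡-Reasoning
    comm : ∀ q u a → a + u * q ≡ q * u + a
    comm = solve-∀

  quotient-unique : ∀ {c Q Z₁ R} → c * Q < Z₁ * Q + R → Z₁ * Q + R < (c + 1) * Q → R < Q → Z₁ ≡ c
  quotient-unique {c} {Q} {Z₁} {R} lower upper R<Q = ≤-antisym (s≤s⁻¹ Z₁<c+1) (s≤s⁻¹ c<Z₁+1)
    where
    c<Z₁+1 : c < suc Z₁
    c<Z₁+1 = *-cancelʳ-< Q _ _ (<-≤-trans lower (subst (Z₁ * Q + R ≤_) (+-comm (Z₁ * Q) Q) (+-monoʳ-≤ (Z₁ * Q) (<⇒≤ R<Q))))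
    Z₁<c+1 : Z₁ < suc c
    Z₁<c+1 = *-cancelʳ-< Q _ _ (≤-<-trans (m≤m+n (Z₁ * Q) R) (subst (λ x → Z₁ * Q + R < x * Q) (+-comm c 1) upper))

  bracket-of-approximation : ∀ {Z Y X P Q c} → ∣ Z * Y - X * (P * Q) ∣ < Q → c * Y < P * X → P * X < (c + 1) * Y →
                             c * Q < Z × Z < (c + 1) * Q
  bracket-of-approximation {Z} {Y} {X} {P} {Q} {c} close lower upper =
    *-cancelʳ-< Y _ _ (+-cancelʳ-< Q _ _ (begin-strict
      c * Q * Y + Q                ≡⟨ regroup₁ c Q Y ⟩
      suc (c * Y) * Q              ≤⟨ *-monoˡ-≤ Q lower ⟩
      P * X * Q                    ≡⟨ regroup₂ P X Q ⟩
      X * (P * Q)                  ≤⟨ m≤n+∣m-n∣ (X * (P * Q)) (Z * Y) ⟩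
      Z * Y + ∣ X * (P * Q) - Z * Y ∣ <⟨ +-monoʳ-< (Z * Y) (subst (_< Q) (∣-∣-comm (Z * Y) _) close) ⟩
      Z * Y + Q                    ∎)) ,
    *-cancelʳ-< Y _ _ (begin-strict
      Z * Y                        ≤⟨ m≤n+∣m-n∣ (Z * Y) (X * (P * Q)) ⟩
      X * (P * Q) + ∣ Z * Y - X * (P * Q) ∣ <⟨ +-monoʳ-< (X * (P * Q)) close ⟩
      X * (P * Q) + Q              ≡⟨ regroup₃ P X Q ⟩
      suc (P * X) * Q              ≤⟨ *-monoˡ-≤ Q upper ⟩
      (c + 1) * Y * Q              ≡⟨ regroup₄ c Y Q ⟩
      (c + 1) * Q * Y              ∎)
    where
    open ≤-Reasoning
    regroup₁ : ∀ c Q Y → c * Q * Y + Q ≡ suc (c * Y) * Q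
    regroup₁ = solve-∀
    regroup₂ : ∀ P X Q → P * X * Q ≡ X * (P * Q)
    regroup₂ = solve-∀
    regroup₃ : ∀ P X Q → X * (P * Q) + Q ≡ suc (P * X) * Q
    regroup₃ = solve-∀
    regroup₄ : ∀ c Y Q → (c + 1) * Y * Q ≡ (c + 1) * Q * Y
    regroup₄ = solve-∀

  ∣m⊖n∣≡∣m-n∣ : ∀ m n → ℤ.∣ m ⊖ n ∣ ≡ ∣ m - n ∣
  ∣m⊖n∣≡∣m-n∣ m n with ≤-total m n
  ... | inj₁ m≤n = trans (ℤ.∣⊖∣-≤ m≤n) (sym (m≤n⇒∣m-n∣≡n∸m m≤n))
  ... | inj₂ n≤m = trans (ℤ.∣m⊖n∣≡∣n⊖m∣ m n) (trans (ℤ.∣⊖∣-≤ n≤m) (sym (m≤n⇒∣n-m∣≡n∸m n≤m)))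

  toℚᵘ-/ : ∀ a n .{{_ : NonZero n}} → toℚᵘ ((ℤ.+ a) ℚ./ n) ℚᵘ.≃ (ℤ.+ a) ℚᵘ./ n
  toℚᵘ-/ a (suc n) = ℚ.toℚᵘ-fromℚᵘ (mkℚᵘ (ℤ.+ a) n)

  /-+-/ : ∀ a b q D .{{_ : NonZero q}} .{{_ : NonZero D}} →
          (ℤ.+ a) ℚᵘ./ D ℚᵘ.+ ((ℤ.+ b) ℚᵘ./ (q * D)) {{m*n≢0 q D}} ℚᵘ.≃ ((ℤ.+ (q * a + b)) ℚᵘ./ (q * D)) {{m*n≢0 q D}}
  /-+-/ a b q@(suc _) D@(suc _) = *≡* (begin
    (ℤ.+ a ℤ.* ℤ.+ (q * D) ℤ.+ ℤ.+ b ℤ.* ℤ.+ D) ℤ.* ℤ.+ (q * D)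
      ≡⟨ cong (ℤ._* ℤ.+ (q * D)) (cong₂ ℤ._+_ (sym (ℤ.pos-* a (q * D))) (sym (ℤ.pos-* b D))) ⟩
    (ℤ.+ (a * (q * D)) ℤ.+ ℤ.+ (b * D)) ℤ.* ℤ.+ (q * D)
      ≡⟨ sym (ℤ.pos-* (a * (q * D) + b * D) (q * D)) ⟩
    ℤ.+ ((a * (q * D) + b * D) * (q * D))
      ≡⟨ cong ℤ.+_ (regroup a b q D) ⟩
    ℤ.+ ((q * a + b) * (D * (q * D)))
      ≡⟨ ℤ.pos-* (q * a + b) (D * (q * D)) ⟩
    ℤ.+ (q * a + b) ℤ.* ℤ.+ (D * (q * D)) ∎)
    where
    open ≡-Reasoning
    regroup : ∀ a b q D → (a * (q * D) + b * D) * (q * D) ≡ (q * a + b) * (D * (q * D))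
    regroup = solve-∀

  ∣/-/∣<1/⇒ : ∀ a b D Y W .{{_ : NonZero D}} .{{_ : NonZero Y}} .{{_ : NonZero W}} →
              ℚᵘ.∣ (ℤ.+ a) ℚᵘ./ D ℚᵘ.- (ℤ.+ b) ℚᵘ./ Y ∣ ℚᵘ.< (ℤ.+ 1) ℚᵘ./ W → ∣ a * Y - b * D ∣ * W < D * Y
  ∣/-/∣<1/⇒ a b D@(suc _) Y@(suc _) W@(suc _) (*<* lt) = ℤ.drop‿+<+ (subst₂ ℤ._<_ lhs (ℤ.*-identityˡ _) lt)
    where
    numerator : ℤ.+ a ℤ.* ℤ.+ Y ℤ.+ ℤ.- (ℤ.+ b) ℤ.* ℤ.+ D ≡ (a * Y) ⊖ (b * D)
    numerator = trans (cong₂ ℤ._+_ (sym (ℤ.pos-* a Y))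
                        (trans (sym (ℤ.neg-distribˡ-* (ℤ.+ b) (ℤ.+ D))) (cong ℤ.-_ (sym (ℤ.pos-* b D)))))
                      (ℤ.m-n≡m⊖n (a * Y) (b * D))
    lhs : ℤ.+ ℤ.∣ ℤ.+ a ℤ.* ℤ.+ Y ℤ.+ ℤ.- (ℤ.+ b) ℤ.* ℤ.+ D ∣ ℤ.* ℤ.+ W ≡ ℤ.+ (∣ a * Y - b * D ∣ * W)
    lhs = trans (cong (λ z → ℤ.+ ℤ.∣ z ∣ ℤ.* ℤ.+ W) numerator)
                (trans (cong (λ n → ℤ.+ n ℤ.* ℤ.+ W) (∣m⊖n∣≡∣m-n∣ (a * Y) (b * D))) (sym (ℤ.pos-* ∣ a * Y - b * D ∣ W)))

  partialSum≃digitPrefix : ∀ {q} .{{_ : NonZero q}} d n →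
                           toℚᵘ (partialSum q d n) ℚᵘ.≃ ((ℤ.+ digitPrefix q d n) ℚᵘ./ (q ^ n)) {{m^n≢0 q n}}
  partialSum≃digitPrefix d zero    = *≡* refl
  partialSum≃digitPrefix {q} {{q≢0}} d (suc n) = ℚᵘ.≃-trans (ℚ.toℚᵘ-homo-+ (partialSum q d n) (digitTerm q d n))
    (ℚᵘ.≃-trans (ℚᵘ.+-cong (partialSum≃digitPrefix d n) (toℚᵘ-/ (toℕ (d n)) (q ^ suc n) {{m^n≢0 q (suc n)}}))
      (/-+-/ (digitPrefix q d n) (toℕ (d n)) q (q ^ n) {{q≢0}} {{m^n≢0 q n}}))

  sumsTo⇒approximation : ∀ {q} .{{_ : NonZero q}} {d x X Y′} → SumsTo q d x → toℚᵘ x ≡ mkℚᵘ (ℤ.+ X) Y′ →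
    ∀ k → ∃ λ N₀ → ∣ digitPrefix q d (k + N₀) * suc Y′ - X * (q ^ k * q ^ N₀) ∣ < q ^ N₀
  sumsTo⇒approximation {q} {d} {x} {X} {Y′} x-sum x≡X/Y k = N₀ , close
    where
    Y W : ℕ
    Y = suc Y′
    W = Y * q ^ k
    instance
      W≢0 : NonZero W
      W≢0 = m*n≢0 Y (q ^ k) {{_}} {{m^n≢0 q k}}
    ε : ℚ
    ε = (ℤ.+ 1) ℚ./ W
    convergence : ∃ λ N → ∀ n → N ≤ n → ℚ.∣ partialSum q d n ℚ.- x ∣ ℚ.< ε
    convergence = x-sum ε (ℚ.normalize-pos 1 W)
    N₀ M : ℕ
    N₀ = proj₁ convergence
    M = k + N₀
    instance
      q^M≢0 : NonZero (q ^ M)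
      q^M≢0 = m^n≢0 q M
    Z : ℕ
    Z = digitPrefix q d M
    ∣S-x∣≃ : toℚᵘ ℚ.∣ partialSum q d M ℚ.- x ∣ ℚᵘ.≃ ℚᵘ.∣ (ℤ.+ Z) ℚᵘ./ q ^ M ℚᵘ.- (ℤ.+ X) ℚᵘ./ Y ∣
    ∣S-x∣≃ = ℚᵘ.≃-trans (ℚ.toℚᵘ-homo-∣-∣ (partialSum q d M ℚ.- x))
               (ℚᵘ.∣-∣-cong (ℚᵘ.≃-trans (ℚ.toℚᵘ-homo-+ (partialSum q d M) (ℚ.- x))
                 (ℚᵘ.+-cong (partialSum≃digitPrefix d M) (ℚᵘ.≃-trans (ℚ.toℚᵘ-homo‿- x) (ℚᵘ.-‿cong (ℚᵘ.≃-reflexive x≡X/Y))))))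
    ∣S-x∣<1/W : ℚᵘ.∣ (ℤ.+ Z) ℚᵘ./ q ^ M ℚᵘ.- (ℤ.+ X) ℚᵘ./ Y ∣ ℚᵘ.< (ℤ.+ 1) ℚᵘ./ W
    ∣S-x∣<1/W = ℚᵘ.<-respˡ-≃ ∣S-x∣≃ (ℚᵘ.<-respʳ-≃ (toℚᵘ-/ 1 W) (ℚ.toℚᵘ-mono-< (proj₂ convergence M (m≤n+m N₀ k))))
    q^M≡ : q ^ M ≡ q ^ k * q ^ N₀
    q^M≡ = ^-distribˡ-+-* q k N₀
    close : ∣ Z * Y - X * (q ^ k * q ^ N₀) ∣ < q ^ N₀
    close = *-cancelʳ-< W _ _ (begin-strict
      ∣ Z * Y - X * (q ^ k * q ^ N₀) ∣ * W ≡⟨ cong (λ t → ∣ Z * Y - X * t ∣ * W) (sym q^M≡) ⟩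
      ∣ Z * Y - X * q ^ M ∣ * W            <⟨ ∣/-/∣<1/⇒ Z X (q ^ M) Y W ∣S-x∣<1/W ⟩
      q ^ M * Y                            ≡⟨ cong (_* Y) q^M≡ ⟩
      q ^ k * q ^ N₀ * Y                   ≡⟨ regroup (q ^ k) (q ^ N₀) Y ⟩
      q ^ N₀ * W                           ∎)
      where
      open ≤-Reasoning
      regroup : ∀ a b c → a * b * c ≡ b * (c * a)
      regroup = solve-∀

  sumsTo⇒digitPrefix : ∀ {q} .{{_ : NonZero q}} {d x X Y′} → SumsTo q d x → toℚᵘ x ≡ mkℚᵘ (ℤ.+ X) Y′ →
    ∀ k c → c * suc Y′ < q ^ k * X → q ^ k * X < (c + 1) * suc Y′ → digitPrefix q d k ≡ c
  sumsTo⇒digitPrefix {q} {d} {X = X} x-sum x≡X/Y k c lower upper =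
    let N₀ , close = sumsTo⇒approximation x-sum x≡X/Y k
        R , split , R<q^N₀ = digitPrefix-+ q d k N₀
        above , below = bracket-of-approximation {X = X} {q ^ k} {c = c} close lower upper
    in  quotient-unique (subst (c * q ^ N₀ <_) split above) (subst (_< (c + 1) * q ^ N₀) split below) R<q^N₀

  sumsTo⇒digit : ∀ {q} .{{_ : NonZero q}} {d X Y′ m} .{c : Coprime X (suc Y′)} → SumsTo q d (mkℚ (ℤ.+ X) Y′ c) →
                 StrictDigit q (toℕ m) X (suc Y′) → ∃ λ n → d n ≡ m
  sumsTo⇒digit {q} {d} {m = m} x-sum (strictDigit n N above below) =
    n , toℕ-injective (digit-unique q (toℕ<n (d n)) (toℕ<n m)
          (sumsTo⇒digitPrefix x-sum refl (suc n) (q * N + toℕ m) above below))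

  x*P≡A/B⇒cross : ∀ x P A b .{c : Coprime A (suc b)} → x ℚ.* ((ℤ.+ P) ℚ./ 1) ≡ mkℚ (ℤ.+ A) b c →
                  ℚ.↥ x ℤ.* ℤ.+ (P * suc b) ≡ ℤ.+ (A * ℚ.↧ₙ x)
  x*P≡A/B⇒cross x@(mkℚ X Y′ _) P A b x*P≡A/B =
    extract (ℚᵘ.≃-trans (ℚᵘ.*-cong (ℚᵘ.≃-refl {toℚᵘ x}) (ℚᵘ.≃-sym (toℚᵘ-/ P 1)))
              (ℚᵘ.≃-trans (ℚᵘ.≃-sym (ℚ.toℚᵘ-homo-* x ((ℤ.+ P) ℚ./ 1))) (ℚ.toℚᵘ-cong x*P≡A/B)))
    where
    extract : mkℚᵘ X Y′ ℚᵘ.* mkℚᵘ (ℤ.+ P) 0 ℚᵘ.≃ mkℚᵘ (ℤ.+ A) b → X ℤ.* ℤ.+ (P * suc b) ≡ ℤ.+ (A * suc Y′)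
    extract (*≡* e) = begin
      X ℤ.* ℤ.+ (P * suc b)             ≡⟨ cong (X ℤ.*_) (ℤ.pos-* P (suc b)) ⟩
      X ℤ.* (ℤ.+ P ℤ.* ℤ.+ suc b)       ≡⟨ sym (ℤ.*-assoc X (ℤ.+ P) (ℤ.+ suc b)) ⟩
      X ℤ.* ℤ.+ P ℤ.* ℤ.+ suc b         ≡⟨ e ⟩
      ℤ.+ A ℤ.* ℤ.+ suc (Y′ * 1)        ≡⟨ sym (ℤ.pos-* A (suc (Y′ * 1))) ⟩
      ℤ.+ (A * suc (Y′ * 1))            ≡⟨ cong (λ y → ℤ.+ (A * suc y)) (*-identityʳ Y′) ⟩
      ℤ.+ (A * suc Y′)                  ∎
      where open ≡-Reasoning

  strictDigit∉K : ∀ {q} .{{_ : NonZero q}} {𝒜 : Subset q} {m x P A b} .{c : Coprime A (suc b)} →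
    InK q 𝒜 x → x ℚ.* ((ℤ.+ P) ℚ./ 1) ≡ mkℚ (ℤ.+ A) b c → 0 < P → m ∉ 𝒜 → ¬ StrictDigit q (toℕ m) A (suc b * P)
  strictDigit∉K {q} {𝒜} {m} {x@(mkℚ (ℤ.+ X) Y′ _)} {P} {A} {b} (d , digits∈𝒜 , x-sum) x*P≡A/B 0<P m∉𝒜 A/bP-digit =
    m∉𝒜 (subst (_∈ 𝒜) (proj₂ digit-m) (digits∈𝒜 (proj₁ digit-m)))
    where
    instance
      bP≢0 : NonZero (suc b * P)
      bP≢0 = m*n≢0 (suc b) P {{_}} {{>-nonZero 0<P}}
    A*Y≡X*bP : A * suc Y′ ≡ X * (suc b * P)
    A*Y≡X*bP = trans (sym (ℤ.+-injective (trans (ℤ.pos-* X (P * suc b)) (x*P≡A/B⇒cross x P A b x*P≡A/B))))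
                     (cong (X *_) (*-comm P (suc b)))
    digit-m : ∃ λ n → d n ≡ m
    digit-m = sumsTo⇒digit x-sum (strictDigit-cong {q} {toℕ m} {A} {suc b * P} {X} {suc Y′} A*Y≡X*bP A/bP-digit)
  strictDigit∉K {x = x@(mkℚ ℤ.-[1+ k ] Y′ _)} {P} {A} {b} _ x*P≡A/B 0<P _ _ =
    negative≢positive k (*-mono-≤ 0<P (s≤s z≤n)) (x*P≡A/B⇒cross x P A b x*P≡A/B)
    where
    negative≢positive : ∀ k {u w} → 0 < u → ℤ.-[1+ k ] ℤ.* ℤ.+ u ≢ ℤ.+ w
    negative≢positive k {suc u} _ ()

  -- Finiteness

  ∣p∣<n⇒∃∉ : ∀ {n} (p : Subset n) → ∣ p ∣ < n → ∃ λ i → i ∉ p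
  ∣p∣<n⇒∃∉ (outside ∷ p) _ = zero , λ ()
  ∣p∣<n⇒∃∉ (inside ∷ p) ∣p∣<n with ∣p∣<n⇒∃∉ p (s≤s⁻¹ ∣p∣<n)
  ... | i , i∉p = suc i , λ { (there i∈p) → i∉p i∈p }

  vecsBelow : ∀ ℓ → ℕ → List (Vec ℕ ℓ)
  vecsBelow zero    K = [] List.∷ List.[]
  vecsBelow (suc ℓ) K = cartesianProductWith _∷_ (upTo K) (vecsBelow ℓ K)

  ∈-vecsBelow : ∀ {ℓ} K (ks : Vec ℕ ℓ) → (∀ j → lookup ks j < K) → ks List.∈ vecsBelow ℓ K
  ∈-vecsBelow K []       _       = List.here refl
  ∈-vecsBelow K (k ∷ ks) ks<K = ∈-cartesianProductWith⁺ _∷_ (∈-upTo⁺ (ks<K zero)) (∈-vecsBelow K ks (ks<K ∘ suc))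

  finite-if-bounded : ∀ {ℓ} (P : Vec ℕ ℓ → Set) → (∀ j → ∃ λ K → ∀ ks → P ks → lookup ks j < K) → FiniteSet P
  finite-if-bounded {ℓ} P bounded = vecsBelow ℓ K , λ ks Pks → ∈-vecsBelow K ks λ j → <-≤-trans (proj₂ (bounded j) ks Pks) (K-bound j)
    where
    common-bound : ∀ ℓ (f : Fin ℓ → ℕ) → ∃ λ K → ∀ j → f j ≤ K
    common-bound zero    f = 0 , λ ()
    common-bound (suc ℓ) f with common-bound ℓ (f ∘ suc)
    ... | K , f≤K = f zero + K , λ { zero → m≤m+n (f zero) K ; (suc j) → ≤-trans (f≤K j) (m≤n+m K (f zero)) }
    K : ℕ
    K = proj₁ (common-bound ℓ (proj₁ ∘ bounded))
    K-bound : ∀ j → proj₁ (bounded j) ≤ K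
    K-bound = proj₂ (common-bound ℓ (proj₁ ∘ bounded))

open import Data.Nat using (ℕ; _≤_; _<_; NonZero; suc; s≤s; z≤n; z<s)
open import Data.Nat.Properties using (≤-trans; ≰⇒>)
open import Data.Integer using (+_; -[1+_])
open import Data.Rational using (ℚ; _/_; _*_; Positive; mkℚ)
open import Data.Fin.Subset using (Subset; ∣_∣; _∉_)
open import Data.Vec using (Vec; lookup)
open import Data.Fin using (Fin)
open import Data.Product using (∃; _×_; _,_; proj₂)
open import Relation.Binary.PropositionalEquality using (_≡_)

theorem4p1 : (q : ℕ) .{{_ : NonZero q}} → 3 ≤ q →
    (𝒜 : Subset q) → 1 < ∣ 𝒜 ∣ → ∣ 𝒜 ∣ < q →
    (ℓ : ℕ) (ps : Vec ℕ ℓ) →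
    (∀ (j : Fin ℓ) → 2 ≤ lookup ps j) →
    (∀ (j : Fin ℓ) → HasPrimeFactorNotDividing q (lookup ps j)) →
    (α : ℚ) → Positive α →
    FiniteSet (λ ks → ∃ λ (x : ℚ) → InK q 𝒜 x × x * (+ prodPow ps ks / 1) ≡ α)
theorem4p1 q q≥3 𝒜 _ ∣𝒜∣<q ℓ ps ps≥2 prime-factor α@(mkℚ (+ suc a) b _) _ =
  finite-if-bounded _ λ j → bound j (prime-factor j)
  where
  ps>0 : ∀ j → 0 < lookup ps j
  ps>0 j = ≤-trans (s≤s z≤n) (ps≥2 j)
  missing-digit : ∃ λ m → m ∉ 𝒜
  missing-digit = ∣p∣<n⇒∃∉ 𝒜 ∣𝒜∣<q
  bound : ∀ j → HasPrimeFactorNotDividing q (lookup ps j) →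
          ∃ λ K → ∀ ks → (∃ λ x → InK q 𝒜 x × x * (+ prodPow ps ks / 1) ≡ α) → lookup ks j < K
  bound j (r , r-prime , r∣p , r∤q) =
    let K , hit = strictDigit-of-large-exponent {A = suc a} {suc b} (≤-trans (s≤s (s≤s z≤n)) q≥3) z<s ps ps>0 j r-prime r∣p r∤q
    in  K , λ { ks (x , x∈K , x*P≡α) → ≰⇒> λ K≤k →
                  strictDigit∉K {P = prodPow ps ks} x∈K x*P≡α (prodPow>0 ps ks ps>0) (proj₂ missing-digit) (hit ks K≤k) }
theorem4p1 q q≥3 𝒜 _ ∣𝒜∣<q ℓ ps ps≥2 prime-factor (mkℚ (+ 0) b _) ()
theorem4p1 q q≥3 𝒜 _ ∣𝒜∣<q ℓ ps ps≥2 prime-factor (mkℚ -[1+ n ] b _) ()
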